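{- For every Boolean function $f:\{0,1\}^n\to\{0,1\}$, $$\mathrm{Rank}(f)\le (\mathrm{C}_0(f)-1)(\mathrm{C}_1(f)-1)+1.$$ Moreover, the inequality is tight, as witnessed by the $\mathrm{AND}_n$ and $\mathrm{OR}_n$ functions.
   Context: For $a\in\{0,1\}^n$, $\mathrm{C}(f,a)$ is the minimum size of $S\subseteq[n]$ such that every $a'$ agreeing with $a$ on $S$ has $f(a')=f(a)$. $\mathrm{C}_b(f)=\max\{\mathrm{C}(f,a):a\in f^{ -1}(b)\}$ (taken as $0$ if $f^{ -1}(b)=\emptyset$). A decision tree queries single variables and has $0/1$ leaves. Rank of a rooted binary tree: leaves have rank $0$; an internal node with children of ranks $a,b$ has rank $a+1$ if $a=b$, else $\max\{a,b\}$; $\mathrm{Rank}(f)$ is the minimum rank of a decision tree computing $f$. -}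

module Defs where

open import Data.Nat using (ℕ; zero; suc; _⊓_; _⊔_; _≤_; _≡ᵇ_)
open import Data.Bool using (Bool; true; false; _∧_; _∨_; not; if_then_else_)
open import Data.Fin using (Fin)
open import Data.Vec using (Vec; []; _∷_; lookup)
open import Data.List using (List; [_]; map; _++_; foldr; filter)
open import Data.Fin.Subset using (Subset; inside; outside; ∣_∣)
open import Data.Product using (Σ; _×_; _,_)
open import Relation.Binary.PropositionalEquality using (_≡_)

-- Inputs x ∈ {0,1}^n are vectors of Booleans (false = 0, true = 1).
BoolFn : ℕ → Set
BoolFn n = Vec Bool n → Bool

allInputs : (n : ℕ) → List (Vec Bool n)
allInputs zero    = [ [] ]
allInputs (suc n) = map (false ∷_) (allInputs n) ++ map (true ∷_) (allInputs n)

-- All subsets of [n] (a subset is a Vec of inside/outside flags).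
allSubsets : (n : ℕ) → List (Subset n)
allSubsets = allInputs

eqBit : Bool → Bool → Bool
eqBit true  true  = true
eqBit false false = true
eqBit _     _     = false

agreeOn : {n : ℕ} → Subset n → Vec Bool n → Vec Bool n → Bool
agreeOn []            []       []       = true
agreeOn (inside  ∷ S) (x ∷ a) (y ∷ b) = eqBit x y ∧ agreeOn S a b
agreeOn (outside ∷ S) (x ∷ a) (y ∷ b) = agreeOn S a b

allL : {A : Set} → (A → Bool) → List A → Bool
allL p = foldr (λ x r → p x ∧ r) true

isCertificate : {n : ℕ} → BoolFn n → Vec Bool n → Subset n → Bool
isCertificate {n} f a S =
  allL (λ a' → not (agreeOn S a a') ∨ eqBit (f a') (f a)) (allInputs n)

-- C(f,a): minimum size of a certificate S for a.  (The full set [n] is always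
-- a certificate, of size n, so starting the minimum at n is harmless.)
C : {n : ℕ} → BoolFn n → Vec Bool n → ℕ
C {n} f a =
  foldr (λ S m → if isCertificate f a S then ∣ S ∣ ⊓ m else m) n (allSubsets n)

-- C_b(f) = max { C(f,a) : f(a) = b }, and 0 if f⁻¹(b) is empty.
Cb : {n : ℕ} → Bool → BoolFn n → ℕ
Cb {n} b f =
  foldr (λ a m → if eqBit (f a) b then C f a ⊔ m else m) 0 (allInputs n)

C₀ C₁ : {n : ℕ} → BoolFn n → ℕ
C₀ = Cb false
C₁ = Cb true

data DTree (n : ℕ) : Set where
  leaf : Bool → DTree n
  node : Fin n → DTree n → DTree n → DTree n

eval : {n : ℕ} → DTree n → Vec Bool n → Bool
eval (leaf b)       x = b
eval (node i t₀ t₁) x = if lookup x i then eval t₁ x else eval t₀ x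

rank : {n : ℕ} → DTree n → ℕ
rank (leaf _) = 0
rank (node i t₀ t₁) =
  if rank t₀ ≡ᵇ rank t₁ then suc (rank t₀) else (rank t₀ ⊔ rank t₁)

Computes : {n : ℕ} → DTree n → BoolFn n → Set
Computes t f = ∀ x → eval t x ≡ f x

RankLe : {n : ℕ} → BoolFn n → ℕ → Set
RankLe {n} f k = Σ (DTree n) (λ t → Computes t f × rank t ≤ k)

RankIs : {n : ℕ} → BoolFn n → ℕ → Set
RankIs {n} f k = RankLe f k × ((t : DTree n) → Computes t f → k ≤ rank t)

AND OR : (n : ℕ) → BoolFn n
AND zero    []      = true
AND (suc n) (x ∷ v) = x ∧ AND n v
OR  zero    []      = false
OR  (suc n) (x ∷ v) = x ∨ OR n v

{-# OPTIONS --safe #-}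
-- Work on a subcube ρ on which every 0-input has a certificate of size ≤ k₀ and every
-- 1-input one of size ≤ k₁ (certificates relative to ρ). Pick a 0-input a with certificate
-- S and query the variables of S: the path that keeps agreeing with a ends in a 0-leaf,
-- and off that path the remaining variables of S are queried too, so that S is fixed.
-- A 1-certificate in such a subcube must meet S, since a 0- and a 1-certificate that were
-- disjoint would both certify the input equal to a on S and to the 1-input elsewhere;
-- dropping S from it lowers k₁ by one. If the subtrees below S have rank ≤ r + 1, the
-- whole tree has rank ≤ |S| + r, which gives R(k₀, k₁) ≤ k₀ - 1 + R(k₀, k₁ - 1). For k₁ = 1
-- the same step on a 1-input lowers k₀ instead and shows R(k₀, 1) ≤ 1.
-- AND and OR attain the bound because they are nonconstant and have C₀ = 1, resp. C₁ = 1.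
module Submission where

open import Defs
open import Data.Nat using (ℕ; zero; suc; _+_; _*_; _∸_; _≤_; _<_; z≤n; s≤s; _⊓_; _⊔_; _≡ᵇ_)
open import Data.Nat.Properties
open import Data.Bool using (Bool; true; false; not; _∧_; _∨_; if_then_else_; T)
open import Data.Bool.Properties using (not-¬; ¬-not; ∧-conicalˡ; ∧-conicalʳ) renaming (_≟_ to _≟ᵇ_)
open import Data.Fin using (Fin; zero; suc) renaming (_≟_ to _≟ᶠ_)
open import Data.Fin.Subset using (Subset; inside; outside; ∣_∣; ⁅_⁆; ⊤) renaming (_∈_ to _∈ₛ_)
open import Data.Fin.Subset.Properties using (∣⊤∣≡n; ∣⁅x⁆∣≡1; ∈⊤; x∈⁅x⁆)
open import Data.Vec using (Vec; []; _∷_; lookup; tabulate; replicate; here; there)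
open import Data.Vec.Properties using (lookup∘tabulate)
open import Data.Vec.Relation.Binary.Pointwise.Extensional using (ext; Pointwise-≡⇒≡)
open import Data.List using (List; []; _∷_; length; map; filter; foldr)
open import Data.List.Properties using (filter-notAll; length-map)
open import Data.List.Relation.Unary.Any as Any using (Any; here; there; any?; satisfied)
open import Data.List.Membership.Propositional using (_∈_; lose)
open import Data.List.Membership.Propositional.Properties using (∈-map⁺; ∈-++⁺ˡ; ∈-++⁺ʳ; ∈-filter⁺)
open import Data.Product using (Σ; ∃; _×_; _,_)
open import Data.Sum using (_⊎_; inj₁; inj₂)
open import Function using (_∘_)
open import Relation.Nullary using (¬_; Dec; yes; no; does; contradiction; _×-dec_)
open import Relation.Nullary.Decidable using (dec-true; dec-false)
open import Relation.Binary.PropositionalEquality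

allInputs-complete : ∀ {n} (x : Vec Bool n) → x ∈ allInputs n
allInputs-complete []                 = here refl
allInputs-complete {suc n} (false ∷ x) = ∈-++⁺ˡ (∈-map⁺ (false ∷_) (allInputs-complete x))
allInputs-complete {suc n} (true ∷ x)  =
  ∈-++⁺ʳ (map (false ∷_) (allInputs n)) (∈-map⁺ (true ∷_) (allInputs-complete x))

Restriction : ℕ → Set
Restriction n = List (Fin n × Bool)

data _⊨_ {n} (x : Vec Bool n) : Restriction n → Set where
  []  : x ⊨ []
  _∷_ : ∀ {i v ρ} → lookup x i ≡ v → x ⊨ ρ → x ⊨ ((i , v) ∷ ρ)

⊨-head : ∀ {n} {x : Vec Bool n} {i v ρ} → x ⊨ ((i , v) ∷ ρ) → lookup x i ≡ v
⊨-head (xᵢ≡v ∷ _) = xᵢ≡v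

⊨-tail : ∀ {n} {x : Vec Bool n} {i v ρ} → x ⊨ ((i , v) ∷ ρ) → x ⊨ ρ
⊨-tail (_ ∷ x⊨ρ) = x⊨ρ

_⊨?_ : ∀ {n} (x : Vec Bool n) ρ → Dec (x ⊨ ρ)
x ⊨? []            = yes []
x ⊨? ((i , v) ∷ ρ) with lookup x i ≟ᵇ v | x ⊨? ρ
... | yes xᵢ≡v | yes x⊨ρ = yes (xᵢ≡v ∷ x⊨ρ)
... | no xᵢ≢v  | _       = no (xᵢ≢v ∘ ⊨-head)
... | yes _    | no ¬x⊨ρ = no (¬x⊨ρ ∘ ⊨-tail)

_⊑_ : ∀ {n} → Restriction n → Restriction n → Set
ρ′ ⊑ ρ = ∀ {x} → x ⊨ ρ′ → x ⊨ ρ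

Agree : ∀ {n} → List (Fin n) → Vec Bool n → Vec Bool n → Set
Agree L x y = ∀ {i} → i ∈ L → lookup x i ≡ lookup y i

Fixes : ∀ {n} → Restriction n → List (Fin n) → Set
Fixes ρ L = ∀ {x y} → x ⊨ ρ → y ⊨ ρ → Agree L x y

fixes-∷ : ∀ {n} {ρ ρ′ : Restriction n} {i v L} → ρ′ ⊑ ((i , v) ∷ ρ) → Fixes ρ′ L → Fixes ρ′ (i ∷ L)
fixes-∷ ρ′⊑ fixes x⊨ y⊨ (here refl)  = trans (⊨-head (ρ′⊑ x⊨)) (sym (⊨-head (ρ′⊑ y⊨)))
fixes-∷ ρ′⊑ fixes x⊨ y⊨ (there i∈L) = fixes x⊨ y⊨ i∈L

OnRefinementsFixing : ∀ {n} → Restriction n → List (Fin n) → (Restriction n → Set) → Set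
OnRefinementsFixing ρ L P = ∀ {ρ′} → ρ′ ⊑ ρ → Fixes ρ′ L → P ρ′

onRefinementsFixing-∷ : ∀ {n} {ρ : Restriction n} {i L P v}
                      → OnRefinementsFixing ρ (i ∷ L) P → OnRefinementsFixing ((i , v) ∷ ρ) L P
onRefinementsFixing-∷ next ρ′⊑ fixes = next (⊨-tail ∘ ρ′⊑) (fixes-∷ ρ′⊑ fixes)

nodeRank : ℕ → ℕ → ℕ
nodeRank r₀ r₁ = if r₀ ≡ᵇ r₁ then suc r₀ else r₀ ⊔ r₁

nodeRank≤ : ∀ {r₀ r₁ k} → r₀ ≤ k → r₁ ≤ suc k → nodeRank r₀ r₁ ≤ suc k
nodeRank≤ {r₀} {r₁} r₀≤k r₁≤1+k with r₀ ≡ᵇ r₁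
... | true  = s≤s r₀≤k
... | false = ⊔-lub (m≤n⇒m≤1+n r₀≤k) r₁≤1+k

nodeRank≤′ : ∀ {r₀ r₁ k} → r₀ ≤ suc k → r₁ ≤ k → nodeRank r₀ r₁ ≤ suc k
nodeRank≤′ {r₀} {r₁} r₀≤1+k r₁≤k with r₀ ≡ᵇ r₁ in eq
... | true  rewrite ≡ᵇ⇒≡ r₀ r₁ (subst T (sym eq) _) = s≤s r₁≤k
... | false = ⊔-lub r₀≤1+k (m≤n⇒m≤1+n r₁≤k)

nodeRank-pos : ∀ r₀ r₁ → 1 ≤ nodeRank r₀ r₁
nodeRank-pos zero     zero    = s≤s z≤n
nodeRank-pos zero     (suc _) = s≤s z≤n
nodeRank-pos (suc r₀) r₁ with suc r₀ ≡ᵇ r₁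
... | true  = s≤s z≤n
... | false = ≤-trans (s≤s z≤n) (m≤m⊔n (suc r₀) r₁)

module _ {n : ℕ} where
  open import Data.List.Membership.DecPropositional (_≟ᶠ_ {n}) using (_∈?_; _∉?_)

  splice : List (Fin n) → Vec Bool n → Vec Bool n → Vec Bool n
  splice S a x = tabulate λ i → if does (i ∈? S) then lookup a i else lookup x i

  splice-∈ : ∀ {S} a x {i} → i ∈ S → lookup (splice S a x) i ≡ lookup a i
  splice-∈ {S} a x {i} i∈S =
    trans (lookup∘tabulate _ i) (cong (if_then lookup a i else lookup x i) (dec-true (i ∈? S) i∈S))

  splice-∉ : ∀ {S} a x {i} → ¬ i ∈ S → lookup (splice S a x) i ≡ lookup x i
  splice-∉ {S} a x {i} i∉S =
    trans (lookup∘tabulate _ i) (cong (if_then lookup a i else lookup x i) (dec-false (i ∈? S) i∉S))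

  splice-⊨ : ∀ {S a x ρ} → a ⊨ ρ → x ⊨ ρ → splice S a x ⊨ ρ
  splice-⊨ [] [] = []
  splice-⊨ {S} {a} {x} {(i , v) ∷ ρ} (aᵢ≡v ∷ a⊨ρ) (xᵢ≡v ∷ x⊨ρ) with i ∈? S
  ... | yes i∈S = trans (splice-∈ a x i∈S) aᵢ≡v ∷ splice-⊨ {S} a⊨ρ x⊨ρ
  ... | no  i∉S = trans (splice-∉ a x i∉S) xᵢ≡v ∷ splice-⊨ {S} a⊨ρ x⊨ρ

  module _ (f : BoolFn n) where

    ComputesOn : DTree n → Restriction n → Set
    ComputesOn t ρ = ∀ {x} → x ⊨ ρ → eval t x ≡ f x

    RankLeOn : Restriction n → ℕ → Set
    RankLeOn ρ k = Σ (DTree n) λ t → ComputesOn t ρ × rank t ≤ k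

    rankLeOn-mono : ∀ {ρ k k′} → k ≤ k′ → RankLeOn ρ k → RankLeOn ρ k′
    rankLeOn-mono k≤k′ (t , t-computes , t≤k) = t , t-computes , ≤-trans t≤k k≤k′

    constant⇒rankLeOn0 : ∀ {ρ} b → (∀ {x} → x ⊨ ρ → f x ≡ b) → RankLeOn ρ 0
    constant⇒rankLeOn0 b constant = leaf b , sym ∘ constant , z≤n

    node-computes : ∀ {ρ} i t₀ t₁ → ComputesOn t₀ ((i , false) ∷ ρ) → ComputesOn t₁ ((i , true) ∷ ρ)
                  → ComputesOn (node i t₀ t₁) ρ
    node-computes i t₀ t₁ t₀-computes t₁-computes {x} x⊨ρ with lookup x i in xᵢ
    ... | true  = t₁-computes (xᵢ ∷ x⊨ρ)
    ... | false = t₀-computes (xᵢ ∷ x⊨ρ)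

    branch : ∀ {ρ k} i v → RankLeOn ((i , v) ∷ ρ) k → RankLeOn ((i , not v) ∷ ρ) (suc k)
           → RankLeOn ρ (suc k)
    branch i true  (t₁ , c₁ , r₁) (t₀ , c₀ , r₀) =
      node i t₀ t₁ , node-computes i t₀ t₁ c₀ c₁ , nodeRank≤′ r₀ r₁
    branch i false (t₀ , c₀ , r₀) (t₁ , c₁ , r₁) =
      node i t₀ t₁ , node-computes i t₀ t₁ c₀ c₁ , nodeRank≤ r₀ r₁

    queryAll : ∀ {ρ k} L → OnRefinementsFixing ρ L (λ ρ′ → RankLeOn ρ′ k) → RankLeOn ρ (length L + k)
    queryAll []      next = next (λ x⊨ → x⊨) (λ _ _ ())
    queryAll (i ∷ L) next = branch i false
      (queryAll L (onRefinementsFixing-∷ next))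
      (rankLeOn-mono (n≤1+n _) (queryAll L (onRefinementsFixing-∷ next)))

    Certificate : Restriction n → Vec Bool n → List (Fin n) → Set
    Certificate ρ a S = ∀ {y} → y ⊨ ρ → Agree S y a → f y ≡ f a

    followCertificate : ∀ {ρ k a} L → Certificate ρ a L
                      → OnRefinementsFixing ρ L (λ ρ′ → RankLeOn ρ′ (suc k))
                      → RankLeOn ρ (length L + k)
    followCertificate [] cert next = rankLeOn-mono z≤n (constant⇒rankLeOn0 _ λ y⊨ → cert y⊨ λ ())
    followCertificate {ρ} {k} {a} (i ∷ L) cert next =
      branch i (lookup a i)
        (followCertificate L cert′ (onRefinementsFixing-∷ next))
        (subst (RankLeOn _) (+-suc (length L) k) (queryAll L (onRefinementsFixing-∷ next)))
      where
      cert′ : Certificate ((i , lookup a i) ∷ ρ) a L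
      cert′ (yᵢ ∷ y⊨ρ) agree = cert y⊨ρ λ where
        (here refl)  → yᵢ
        (there j∈L) → agree j∈L

    certificates-intersect : ∀ {ρ a x S T} → a ⊨ ρ → x ⊨ ρ → Certificate ρ a S → Certificate ρ x T
                           → f a ≢ f x → Any (_∈ S) T
    certificates-intersect {ρ} {a} {x} {S} {T} a⊨ x⊨ certS certT fa≢fx with any? (_∈? S) T
    ... | yes T∩S = T∩S
    ... | no  T∩S=∅ = contradiction (trans (sym (certS z⊨ z≈a)) (certT z⊨ z≈x)) fa≢fx
      where
      z⊨ : splice S a x ⊨ ρ
      z⊨ = splice-⊨ {S} a⊨ x⊨
      z≈a : Agree S (splice S a x) a
      z≈a = splice-∈ a x
      z≈x : Agree T (splice S a x) x
      z≈x i∈T = splice-∉ a x λ i∈S → T∩S=∅ (lose i∈T i∈S)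

    certificate-restrict : ∀ {ρ ρ′ x S T} → ρ′ ⊑ ρ → Fixes ρ′ S → x ⊨ ρ′
                         → Certificate ρ x T → Certificate ρ′ x (filter (_∉? S) T)
    certificate-restrict {x = x} {S} {T} ρ′⊑ fixes x⊨ certT {y} y⊨ y≈x = certT (ρ′⊑ y⊨) agreeT
      where
      agreeT : Agree T y x
      agreeT {i} i∈T with i ∈? S
      ... | yes i∈S = fixes y⊨ x⊨ i∈S
      ... | no  i∉S = y≈x (∈-filter⁺ (_∉? S) i∈T i∉S)

    CertBounded : Bool → Restriction n → ℕ → Set
    CertBounded b ρ k = ∀ {x} → x ⊨ ρ → f x ≡ b → ∃ λ S → length S ≤ k × Certificate ρ x S

    certBounded-mono : ∀ {b ρ ρ′ k} → ρ′ ⊑ ρ → CertBounded b ρ k → CertBounded b ρ′ k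
    certBounded-mono ρ′⊑ bounded x⊨ fx with bounded (ρ′⊑ x⊨) fx
    ... | S , ∣S∣≤k , cert = S , ∣S∣≤k , cert ∘ ρ′⊑

    certBounded-shrink : ∀ {b ρ ρ′ a S k} → a ⊨ ρ → f a ≡ b → Certificate ρ a S → ρ′ ⊑ ρ → Fixes ρ′ S
                       → CertBounded (not b) ρ (suc k) → CertBounded (not b) ρ′ k
    certBounded-shrink {S = S} a⊨ fa certS ρ′⊑ fixes bounded x⊨ fx with bounded (ρ′⊑ x⊨) fx
    ... | T , ∣T∣≤1+k , certT =
      filter (_∉? S) T , ≤-pred (≤-trans shorter ∣T∣≤1+k) , certificate-restrict ρ′⊑ fixes x⊨ certT
      where
      T∩S : Any (_∈ S) T
      T∩S = certificates-intersect a⊨ (ρ′⊑ x⊨) certS certT λ fa≡fx → not-¬ fa (trans fa≡fx fx)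
      shorter : length (filter (_∉? S) T) < length T
      shorter = filter-notAll (_∉? S) T (Any.map (λ i∈S i∉S → i∉S i∈S) T∩S)

    witness-or-constant : ∀ b ρ → (∃ λ x → x ⊨ ρ × f x ≡ b) ⊎ (∀ {x} → x ⊨ ρ → f x ≡ not b)
    witness-or-constant b ρ with any? (λ x → (x ⊨? ρ) ×-dec (f x ≟ᵇ b)) (allInputs n)
    ... | yes found = inj₁ (satisfied found)
    ... | no  none  = inj₂ λ {x} x⊨ → ¬-not λ fx≡b → none (lose (allInputs-complete x) (x⊨ , fx≡b))

    certBounded0⇒rankLeOn0 : ∀ {b ρ} → CertBounded b ρ 0 → RankLeOn ρ 0
    certBounded0⇒rankLeOn0 {b} {ρ} bounded with witness-or-constant b ρ
    ... | inj₂ constant = constant⇒rankLeOn0 (not b) constant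
    ... | inj₁ (a , a⊨ , fa) with bounded a⊨ fa
    ...   | [] , _ , cert = constant⇒rankLeOn0 (f a) λ y⊨ → cert y⊨ λ ()

    queryCertificate : ∀ {b ρ k r} → CertBounded b ρ k
                     → (∀ {a S} → a ⊨ ρ → f a ≡ b → Certificate ρ a S
                          → OnRefinementsFixing ρ S (λ ρ′ → RankLeOn ρ′ (suc r)))
                     → RankLeOn ρ (k + r)
    queryCertificate {b} {ρ} bounded next with witness-or-constant b ρ
    ... | inj₂ constant = rankLeOn-mono z≤n (constant⇒rankLeOn0 (not b) constant)
    ... | inj₁ (a , a⊨ , fa) with bounded a⊨ fa
    ...   | S , ∣S∣≤k , cert =
      rankLeOn-mono (+-monoˡ-≤ _ ∣S∣≤k) (followCertificate S cert (next a⊨ fa cert))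

    rank≤certificateBound : ∀ k₀ k₁ {ρ} → CertBounded false ρ k₀ → CertBounded true ρ k₁
                          → RankLeOn ρ ((k₀ ∸ 1) * (k₁ ∸ 1) + 1)
    rank≤certificateBound zero k₁ bounded₀ _ = rankLeOn-mono z≤n (certBounded0⇒rankLeOn0 bounded₀)
    rank≤certificateBound (suc k₀) zero _ bounded₁ = rankLeOn-mono z≤n (certBounded0⇒rankLeOn0 bounded₁)
    rank≤certificateBound (suc k₀) (suc zero) bounded₀ bounded₁ =
      subst (RankLeOn _) (cong (_+ 1) (sym (*-zeroʳ k₀))) (queryCertificate bounded₁
        λ a⊨ fa cert ρ′⊑ fixes → subst (RankLeOn _) (cong (_+ 1) (*-zeroʳ (k₀ ∸ 1)))
          (rank≤certificateBound k₀ 1 (certBounded-shrink a⊨ fa cert ρ′⊑ fixes bounded₀)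
                                      (certBounded-mono ρ′⊑ bounded₁)))
    rank≤certificateBound (suc k₀) (suc (suc k₁)) bounded₀ bounded₁ =
      subst (RankLeOn _) bound-arith (queryCertificate bounded₀
        λ a⊨ fa cert ρ′⊑ fixes → subst (RankLeOn _) (+-comm (k₀ * k₁) 1)
          (rank≤certificateBound (suc k₀) (suc k₁) (certBounded-mono ρ′⊑ bounded₀)
                                                   (certBounded-shrink a⊨ fa cert ρ′⊑ fixes bounded₁)))
      where
      bound-arith : suc k₀ + k₀ * k₁ ≡ k₀ * suc k₁ + 1
      bound-arith = begin
        suc (k₀ + k₀ * k₁) ≡⟨ +-comm 1 _ ⟩
        k₀ + k₀ * k₁ + 1   ≡⟨ cong (_+ 1) (*-suc k₀ k₁) ⟨
        k₀ * suc k₁ + 1    ∎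
        where open ≡-Reasoning

eqBit-refl : ∀ b → eqBit b b ≡ true
eqBit-refl true  = refl
eqBit-refl false = refl

eqBit⇒≡ : ∀ {a b} → eqBit a b ≡ true → a ≡ b
eqBit⇒≡ {true}  {true}  _ = refl
eqBit⇒≡ {false} {false} _ = refl

allL-sound : ∀ {A : Set} (p : A → Bool) {L x} → allL p L ≡ true → x ∈ L → p x ≡ true
allL-sound p {_ ∷ _} all≡true (here refl)  = ∧-conicalˡ _ _ all≡true
allL-sound p {_ ∷ _} all≡true (there x∈L) = allL-sound p (∧-conicalʳ _ _ all≡true) x∈L

allL-complete : ∀ {A : Set} (p : A → Bool) L → (∀ {x} → x ∈ L → p x ≡ true) → allL p L ≡ true
allL-complete p []      _   = refl
allL-complete p (_ ∷ L) all = cong₂ _∧_ (all (here refl)) (allL-complete p L (all ∘ there))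

agreeOn-sound : ∀ {n} {S : Subset n} a b {i} → agreeOn S a b ≡ true → i ∈ₛ S → lookup a i ≡ lookup b i
agreeOn-sound {S = inside  ∷ S} (x ∷ a) (y ∷ b) agree here        = eqBit⇒≡ (∧-conicalˡ _ _ agree)
agreeOn-sound {S = inside  ∷ S} (x ∷ a) (y ∷ b) agree (there i∈S) =
  agreeOn-sound a b (∧-conicalʳ _ _ agree) i∈S
agreeOn-sound {S = outside ∷ S} (x ∷ a) (y ∷ b) agree (there i∈S) = agreeOn-sound a b agree i∈S

agreeOn-complete : ∀ {n} (S : Subset n) a b → (∀ {i} → i ∈ₛ S → lookup a i ≡ lookup b i)
                 → agreeOn S a b ≡ true
agreeOn-complete []            []      []      _     = refl
agreeOn-complete (inside  ∷ S) (x ∷ a) (y ∷ b) agree =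
  cong₂ _∧_ (trans (cong (eqBit x) (sym (agree here))) (eqBit-refl x))
            (agreeOn-complete S a b (agree ∘ there))
agreeOn-complete (outside ∷ S) (x ∷ a) (y ∷ b) agree = agreeOn-complete S a b (agree ∘ there)

elements : ∀ {n} → Subset n → List (Fin n)
elements []            = []
elements (inside  ∷ S) = zero ∷ map suc (elements S)
elements (outside ∷ S) = map suc (elements S)

length-elements : ∀ {n} (S : Subset n) → length (elements S) ≡ ∣ S ∣
length-elements []            = refl
length-elements (inside  ∷ S) = cong suc (trans (length-map suc (elements S)) (length-elements S))
length-elements (outside ∷ S) = trans (length-map suc (elements S)) (length-elements S)

elements-complete : ∀ {n} {S : Subset n} {i} → i ∈ₛ S → i ∈ elements S
elements-complete {S = inside  ∷ S} here        = here refl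
elements-complete {S = inside  ∷ S} (there i∈S) = there (∈-map⁺ suc (elements-complete i∈S))
elements-complete {S = outside ∷ S} (there i∈S) = ∈-map⁺ suc (elements-complete i∈S)

module _ {A : Set} (p : A → Bool) (w : A → ℕ) where

  foldIf : (ℕ → ℕ → ℕ) → ℕ → List A → ℕ
  foldIf _∙_ d = foldr (λ x m → if p x then w x ∙ m else m) d

  foldIf-⊓-≤ : ∀ {d L x} → x ∈ L → p x ≡ true → foldIf _⊓_ d L ≤ w x
  foldIf-⊓-≤ {L = y ∷ L} (here refl) px rewrite px = m⊓n≤m _ _
  foldIf-⊓-≤ {L = y ∷ L} (there x∈L) px with p y
  ... | true  = ≤-trans (m⊓n≤n _ _) (foldIf-⊓-≤ x∈L px)
  ... | false = foldIf-⊓-≤ x∈L px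

  foldIf-⊓-attained : ∀ {d} L → (∃ λ x → p x ≡ true × w x ≤ d)
                    → ∃ λ x → p x ≡ true × w x ≤ foldIf _⊓_ d L
  foldIf-⊓-attained []      default = default
  foldIf-⊓-attained (y ∷ L) default with p y in py | foldIf-⊓-attained L default
  ... | false | attained = attained
  ... | true  | x , px , wx≤m with ⊓-sel (w y) (foldIf _⊓_ _ L)
  ...   | inj₁ min≡wy = y , py , ≤-reflexive (sym min≡wy)
  ...   | inj₂ min≡m  = x , px , ≤-trans wx≤m (≤-reflexive (sym min≡m))

  foldIf-⊔-≥ : ∀ {d L x} → x ∈ L → p x ≡ true → w x ≤ foldIf _⊔_ d L
  foldIf-⊔-≥ {L = y ∷ L} (here refl) px rewrite px = m≤m⊔n _ _
  foldIf-⊔-≥ {L = y ∷ L} (there x∈L) px with p y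
  ... | true  = ≤-trans (foldIf-⊔-≥ x∈L px) (m≤n⊔m _ _)
  ... | false = foldIf-⊔-≥ x∈L px

  foldIf-⊔-lub : ∀ {d k} L → d ≤ k → (∀ {x} → x ∈ L → p x ≡ true → w x ≤ k) → foldIf _⊔_ d L ≤ k
  foldIf-⊔-lub []      d≤k _     = d≤k
  foldIf-⊔-lub (y ∷ L) d≤k bound with p y in py
  ... | true  = ⊔-lub (bound (here refl) py) (foldIf-⊔-lub L d≤k (bound ∘ there))
  ... | false = foldIf-⊔-lub L d≤k (bound ∘ there)

module _ {n : ℕ} (f : BoolFn n) where

  isCertificate-sound : ∀ {a S y} → isCertificate f a S ≡ true → agreeOn S a y ≡ true → f y ≡ f a
  isCertificate-sound {a} {S} {y} cert agree =
    eqBit⇒≡ (subst (λ b → not b ∨ eqBit (f y) (f a) ≡ true) agree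
                   (allL-sound _ cert (allInputs-complete y)))

  isCertificate-complete : ∀ a S → (∀ {y} → agreeOn S a y ≡ true → f y ≡ f a)
                         → isCertificate f a S ≡ true
  isCertificate-complete a S cert = allL-complete _ (allInputs n) λ {y} _ → certifies y
    where
    certifies : ∀ y → not (agreeOn S a y) ∨ eqBit (f y) (f a) ≡ true
    certifies y with agreeOn S a y in agree
    ... | false = refl
    ... | true  = trans (cong (λ b → eqBit b (f a)) (cert agree)) (eqBit-refl (f a))

  C-attained : ∀ a → ∃ λ S → isCertificate f a S ≡ true × ∣ S ∣ ≤ C f a
  C-attained a = foldIf-⊓-attained (isCertificate f a) ∣_∣ (allSubsets n)
    (⊤ , isCertificate-complete a ⊤ full , ≤-reflexive (∣⊤∣≡n n))
    where
    full : ∀ {y} → agreeOn ⊤ a y ≡ true → f y ≡ f a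
    full {y} agree = cong f (sym (Pointwise-≡⇒≡ (ext λ i → agreeOn-sound a y agree ∈⊤)))

  C≤∣S∣ : ∀ a S → isCertificate f a S ≡ true → C f a ≤ ∣ S ∣
  C≤∣S∣ a S = foldIf-⊓-≤ (isCertificate f a) ∣_∣ (allInputs-complete S)

  C≤Cb : ∀ {b x} → f x ≡ b → C f x ≤ Cb b f
  C≤Cb {b} {x} fx = foldIf-⊔-≥ (λ a → eqBit (f a) b) (C f) (allInputs-complete x)
    (trans (cong (λ c → eqBit c b) fx) (eqBit-refl b))

  Cb≤ : ∀ {b k} → (∀ {x} → f x ≡ b → C f x ≤ k) → Cb b f ≤ k
  Cb≤ {b} bound =
    foldIf-⊔-lub (λ a → eqBit (f a) b) (C f) (allInputs n) z≤n λ _ fx → bound (eqBit⇒≡ fx)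

  certBounded-Cb : ∀ b → CertBounded f b [] (Cb b f)
  certBounded-Cb b {x} _ fx with C-attained x
  ... | S , cert , ∣S∣≤C =
    elements S ,
    ≤-trans (≤-reflexive (length-elements S)) (≤-trans ∣S∣≤C (C≤Cb fx)) ,
    λ {y} _ y≈x → isCertificate-sound {x} {S} {y} cert
                    (agreeOn-complete S x y (sym ∘ y≈x ∘ elements-complete))

  rank≤bound : RankLe f ((C₀ f ∸ 1) * (C₁ f ∸ 1) + 1)
  rank≤bound with rank≤certificateBound f (C₀ f) (C₁ f) (certBounded-Cb false) (certBounded-Cb true)
  ... | t , t-computes , t≤bound = t , (λ _ → t-computes []) , t≤bound

  Cb≤1 : ∀ b → (∀ {x} → f x ≡ b → ∃ λ i → ∀ {y} → lookup y i ≡ lookup x i → f y ≡ b) → Cb b f ≤ 1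
  Cb≤1 b single = Cb≤ λ {x} fx → let i , certified = single fx in
    ≤-trans (C≤∣S∣ x ⁅ i ⁆ (isCertificate-complete x ⁅ i ⁆ λ {y} agree →
               trans (certified (sym (agreeOn-sound x y agree (x∈⁅x⁆ i)))) (sym fx)))
            (≤-reflexive (∣⁅x⁆∣≡1 i))

  nonconstant⇒rank≥1 : (∃ λ x → f x ≡ true) → (∃ λ y → f y ≡ false) → ∀ t → Computes t f → 1 ≤ rank t
  nonconstant⇒rank≥1 (x , fx) (y , fy) (leaf b) computes =
    contradiction (trans (sym fx) (trans (sym (computes x)) (trans (computes y) fy))) λ ()
  nonconstant⇒rank≥1 _ _ (node i t₀ t₁) _ = nodeRank-pos (rank t₀) (rank t₁)

  rankIs-bound-if-C≤1 : (∃ λ x → f x ≡ true) → (∃ λ y → f y ≡ false) → C₀ f ≤ 1 ⊎ C₁ f ≤ 1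
                      → RankIs f ((C₀ f ∸ 1) * (C₁ f ∸ 1) + 1)
  rankIs-bound-if-C≤1 one-input zero-input small =
    rank≤bound , λ t computes →
      subst (_≤ rank t) (sym (bound≡1 small)) (nonconstant⇒rank≥1 one-input zero-input t computes)
    where
    bound≡1 : ∀ {k₀ k₁} → k₀ ≤ 1 ⊎ k₁ ≤ 1 → (k₀ ∸ 1) * (k₁ ∸ 1) + 1 ≡ 1
    bound≡1 (inj₁ k₀≤1) rewrite m≤n⇒m∸n≡0 k₀≤1 = refl
    bound≡1 {k₀} (inj₂ k₁≤1) rewrite m≤n⇒m∸n≡0 k₁≤1 | *-zeroʳ (k₀ ∸ 1) = refl

AND≡false⇒∃ : ∀ n {x} → AND n x ≡ false → ∃ λ i → lookup x i ≡ false
AND≡false⇒∃ (suc n) {false ∷ x} _ = zero , refl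
AND≡false⇒∃ (suc n) {true  ∷ x} AND≡false with AND≡false⇒∃ n AND≡false
... | i , xᵢ≡false = suc i , xᵢ≡false

lookup≡false⇒AND≡false : ∀ n {x} i → lookup x i ≡ false → AND n x ≡ false
lookup≡false⇒AND≡false (suc n) {false ∷ x} _       _ = refl
lookup≡false⇒AND≡false (suc n) {true  ∷ x} (suc i) xᵢ≡false = lookup≡false⇒AND≡false n i xᵢ≡false

OR≡true⇒∃ : ∀ n {x} → OR n x ≡ true → ∃ λ i → lookup x i ≡ true
OR≡true⇒∃ (suc n) {true  ∷ x} _ = zero , refl
OR≡true⇒∃ (suc n) {false ∷ x} OR≡true with OR≡true⇒∃ n OR≡true
... | i , xᵢ≡true = suc i , xᵢ≡true

lookup≡true⇒OR≡true : ∀ n {x} i → lookup x i ≡ true → OR n x ≡ true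
lookup≡true⇒OR≡true (suc n) {true  ∷ x} _       _ = refl
lookup≡true⇒OR≡true (suc n) {false ∷ x} (suc i) xᵢ≡true = lookup≡true⇒OR≡true n i xᵢ≡true

AND-replicate-true : ∀ n → AND n (replicate n true) ≡ true
AND-replicate-true zero    = refl
AND-replicate-true (suc n) = AND-replicate-true n

OR-replicate-false : ∀ n → OR n (replicate n false) ≡ false
OR-replicate-false zero    = refl
OR-replicate-false (suc n) = OR-replicate-false n

C₀-AND≤1 : ∀ n → C₀ (AND n) ≤ 1
C₀-AND≤1 n = Cb≤1 (AND n) false λ AND≡false → let i , xᵢ≡false = AND≡false⇒∃ n AND≡false in
  i , λ yᵢ≡xᵢ → lookup≡false⇒AND≡false n i (trans yᵢ≡xᵢ xᵢ≡false)

C₁-OR≤1 : ∀ n → C₁ (OR n) ≤ 1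
C₁-OR≤1 n = Cb≤1 (OR n) true λ OR≡true → let i , xᵢ≡true = OR≡true⇒∃ n OR≡true in
  i , λ yᵢ≡xᵢ → lookup≡true⇒OR≡true n i (trans yᵢ≡xᵢ xᵢ≡true)

lemma5p4 : ((n : ℕ) → (f : BoolFn n) → RankLe f ((C₀ f ∸ 1) * (C₁ f ∸ 1) + 1))
           × ((n : ℕ) → RankIs (AND (suc n)) ((C₀ (AND (suc n)) ∸ 1) * (C₁ (AND (suc n)) ∸ 1) + 1)
                        × RankIs (OR (suc n)) ((C₀ (OR (suc n)) ∸ 1) * (C₁ (OR (suc n)) ∸ 1) + 1))
lemma5p4 = (λ _ → rank≤bound) , λ n →
  rankIs-bound-if-C≤1 (AND (suc n))
    (replicate (suc n) true , AND-replicate-true (suc n)) (replicate (suc n) false , refl)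
    (inj₁ (C₀-AND≤1 (suc n))) ,
  rankIs-bound-if-C≤1 (OR (suc n))
    (replicate (suc n) true , refl) (replicate (suc n) false , OR-replicate-false (suc n))
    (inj₂ (C₁-OR≤1 (suc n)))
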